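{- Let $G$ be a connected, simple, locally finite graph, $n\ge1$, $v_0$ a vertex of $G$, $\mathbf{v}_0=(v_0,\ldots,v_0)\in G^n$ and $\mathbf{x}_0=v_0^n\in G^{(n)}$. Let $\eta:G^n\to G^{(n)}$ be the graph map $\eta(v_1,\ldots,v_n)=v_1\cdots v_n$. Then the induced homomorphism $\eta_*:A_1(G^n,\mathbf{v}_0)\to A_1(G^{(n)},\mathbf{x}_0)$ is surjective.
   Context: $G^n$ is the Cartesian power of $G$. The reduced power $G^{(n)}$ has as vertices degree-$n$ monomials in the vertices of $G$ (multisets of $n$ vertices), two monomials adjacent iff one is obtained from the other by replacing one factor $u$ by an adjacent vertex $v$ of $G$. The discrete fundamental group $A_1(K,v)$ consists of based homotopy classes of graph maps $f:\mathbb{Z}\to K$ ($\mathbb{Z}$ the path graph on the integers; graph maps send equal-or-adjacent vertices to equal-or-adjacent vertices) with $f(i)=v$ for $|i|$ large, where a based homotopy is a graph map $h:\mathbb{Z}\times I_m\to K$ ($I_m$ the path on $\{0,\dots,m\}$, Cartesian product) with prescribed end rows and all rows based; the product is concatenation. A based graph map induces a homomorphism on $A_1$ by composition. -}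

module Defs where

open import Data.Nat as ℕ using (ℕ; zero; suc)
open import Data.Integer as ℤ using (ℤ; ∣_∣)
open import Data.Fin using (Fin)
open import Data.Vec using (Vec; lookup; toList; replicate)
open import Data.List using (List; _∷_)
open import Data.List.Membership.Propositional using (_∈_)
open import Data.List.Relation.Binary.Permutation.Propositional using (_↭_)
open import Data.Product using (Σ; _×_; _,_)
open import Data.Sum using (_⊎_)
open import Relation.Nullary using (¬_)
open import Relation.Binary.PropositionalEquality using (_≡_; _≢_)
open import Relation.Binary.Construct.Closure.ReflexiveTransitive using (Star)

record SimpleGraph : Set₁ where
  field
    V     : Set
    _~_   : V → V → Set
    irrefl : ∀ {v} → ¬ (v ~ v)
    sym~  : ∀ {u v} → u ~ v → v ~ u

open SimpleGraph public

Connected : SimpleGraph → Set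
Connected G = ∀ (u w : V G) → Star (_~_ G) u w

LocallyFinite : SimpleGraph → Set
LocallyFinite G = ∀ (v : V G) → Σ (List (V G)) λ L →
  ∀ (w : V G) → ((_~_ G) v w → w ∈ L) × (w ∈ L → (_~_ G) v w)

-- Graphs whose vertices are given by representatives together with an
-- equality relation _≈_ (a setoid of vertices) and an adjacency _~_.
-- Needed because the vertices of the reduced power are multisets.

record SGraph : Set₁ where
  field
    Vx   : Set
    _≈_  : Vx → Vx → Set
    _∼_  : Vx → Vx → Set

open SGraph public

_⊢_≃_ : (K : SGraph) → Vx K → Vx K → Set
K ⊢ x ≃ y = _≈_ K x y ⊎ _∼_ K x y

Power : SimpleGraph → ℕ → SGraph
Power G n = record
  { Vx  = Vec (V G) n
  ; _≈_ = _≡_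
  ; _∼_ = λ x y → Σ (Fin n) λ i → (_~_ G) (lookup x i) (lookup y i)
                     × (∀ j → j ≢ i → lookup x j ≡ lookup y j)
  }

-- Reduced power G^(n) for n = suc k: degree-n monomials (multisets of n
-- vertices), represented by n-tuples up to permutation; x ~ y iff
-- x = u·m and y = v·m with u ~ v in G and m a monomial of degree n-1.
ReducedPower : SimpleGraph → ℕ → SGraph
ReducedPower G k = record
  { Vx  = Vec (V G) (suc k)
  ; _≈_ = λ x y → toList x ↭ toList y
  ; _∼_ = λ x y → Σ (V G) λ u → Σ (V G) λ w → Σ (Vec (V G) k) λ m →
                    (_~_ G) u w × (toList x ↭ (u ∷ toList m))
                                × (toList y ↭ (w ∷ toList m))
  }

-- η : G^n → G^(n), (v₁,…,vₙ) ↦ v₁⋯vₙ (a tuple is sent to its monomial)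
η : ∀ {G : SimpleGraph} {k : ℕ} → Vx (Power G (suc k)) → Vx (ReducedPower G k)
η x = x

module _ (K : SGraph) where

  IsGraphMapℤ : (ℤ → Vx K) → Set
  IsGraphMapℤ f = ∀ i → K ⊢ f i ≃ f (i ℤ.+ ℤ.1ℤ)

  EventuallyAt : Vx K → (ℤ → Vx K) → Set
  EventuallyAt v f = Σ ℕ λ N → ∀ i → N ℕ.≤ ∣ i ∣ → _≈_ K (f i) v

  record BasedLoop (v : Vx K) : Set where
    field
      loop       : ℤ → Vx K
      isGraphMap : IsGraphMapℤ loop
      based      : EventuallyAt v loop

  -- based homotopy h : ℤ × I_m → K (Cartesian product), rows 0..m,
  -- row 0 is f, row m is g, every row based at v.
  BasedHomotopic : Vx K → (f g : ℤ → Vx K) → Set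
  BasedHomotopic v f g = Σ ℕ λ m → Σ (ℤ → ℕ → Vx K) λ h →
      (∀ i j → j ℕ.≤ m → K ⊢ h i j ≃ h (i ℤ.+ ℤ.1ℤ) j)
    × (∀ i j → j ℕ.< m → K ⊢ h i j ≃ h i (suc j))
    × (∀ j → j ℕ.≤ m → EventuallyAt v (λ i → h i j))
    × (∀ i → _≈_ K (h i 0) (f i))
    × (∀ i → _≈_ K (h i m) (g i))

open BasedLoop public

module Submission where

-- A walk in G⁽ⁿ⁾ lifts step by step to a walk in Gⁿ: if the tuple x orders the monomial u·m
-- and the walk moves to w·m with u ~ w, replace one occurrence of u in x by w.  Lifting g
-- from a time at which it already sits at x₀ gives a loop f in Gⁿ with η(f(i)) = g(i) as
-- monomials for every i, so the two loops are homotopic through the constant homotopy.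

open import Defs
open import Data.Nat using (ℕ; suc)
open import Data.Vec using (replicate)
open import Data.Product using (Σ)

import Data.Nat as ℕ
import Data.Nat.Properties as ℕ
open import Data.Integer as ℤ using (ℤ; +_; -[1+_]; ∣_∣)
import Data.Integer.Properties as ℤ
open import Data.Integer.Tactic.RingSolver using (solve-∀)
open import Data.Fin using (Fin; zero; suc)
open import Data.Vec using (Vec; []; _∷_; lookup; toList; _[_]≔_)
open import Data.Vec.Properties using (lookup∘update; lookup∘update′; toList-replicate)
open import Data.Vec.Membership.Propositional.Properties using (∈-toList⁻)
open import Data.Vec.Relation.Unary.Any using (index)
open import Data.Vec.Relation.Unary.Any.Properties using (lookup-index)
open import Data.List using (List; _∷_)
open import Data.List.Relation.Unary.All using (All; []; _∷_)
import Data.List.Relation.Unary.All.Properties as All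
open import Data.List.Relation.Unary.Any using (here)
open import Data.List.Membership.Propositional using (_∈_)
open import Data.List.Relation.Binary.Permutation.Propositional
open import Data.List.Relation.Binary.Permutation.Propositional.Properties
  using (drop-∷; ∈-resp-↭; All-resp-↭)
open import Data.Product using (∃-syntax; Σ-syntax; _,_; proj₁; proj₂; _×_)
open import Data.Sum using (inj₁; inj₂)
open import Relation.Nullary using (yes; no)
open import Relation.Binary.PropositionalEquality as ≡ using (_≡_; refl; cong; subst)

module _ {A : Set} where

  toList-↭-lookup∷ : ∀ {n} (x : Vec A n) (p : Fin n) (w : A) → Σ[ r ∈ List A ]
    (toList x ↭ lookup x p ∷ r) × (toList (x [ p ]≔ w) ↭ w ∷ r)
  toList-↭-lookup∷ (a ∷ x) zero    w = toList x , refl , refl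
  toList-↭-lookup∷ (a ∷ x) (suc p) w with toList-↭-lookup∷ x p w
  ... | r , x↭ , x[p]≔w↭ =
    a ∷ r , trans (prep a x↭) (swap a (lookup x p) refl)
          , trans (prep a x[p]≔w↭) (swap a w refl)

  ∈-toList⇒lookup : ∀ {n} {x : Vec A n} {u : A} → u ∈ toList x → ∃[ p ] lookup x p ≡ u
  ∈-toList⇒lookup u∈x = index (∈-toList⁻ u∈x) , ≡.sym (lookup-index (∈-toList⁻ u∈x))

  All≡⇒replicate : ∀ {n} {v : A} (x : Vec A n) → All (_≡ v) (toList x) → x ≡ replicate n v
  All≡⇒replicate []      []           = refl
  All≡⇒replicate (a ∷ x) (refl ∷ x≡v) = cong (a ∷_) (All≡⇒replicate x x≡v)

  ↭-replicate⇒≡replicate : ∀ {n} {v : A} (x : Vec A n) →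
    toList x ↭ toList (replicate n v) → x ≡ replicate n v
  ↭-replicate⇒≡replicate {n} {v} x x↭ = All≡⇒replicate x (All-resp-↭ (↭-sym x↭) all≡v)
    where
    all≡v : All (_≡ v) (toList (replicate n v))
    all≡v = subst (All (_≡ v)) (≡.sym (toList-replicate n v)) (All.replicate⁺ n refl)

i+n+1≡i+1+n : ∀ i n → i ℤ.+ n ℤ.+ ℤ.1ℤ ≡ i ℤ.+ ℤ.1ℤ ℤ.+ n
i+n+1≡i+1+n = solve-∀

-n+[i+n]≡i : ∀ i n → ℤ.- n ℤ.+ (i ℤ.+ n) ≡ i
-n+[i+n]≡i = solve-∀

i+[+n]+1≡i+[+1+n] : ∀ i n → i ℤ.+ + n ℤ.+ ℤ.1ℤ ≡ i ℤ.+ + suc n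
i+[+n]+1≡i+[+1+n] i n = ≡.trans (ℤ.+-assoc i (+ n) ℤ.1ℤ) (cong (λ m → i ℤ.+ + m) (ℕ.+-comm n 1))

i+N≡-[1+n]⇒N≤∣i∣ : ∀ i N {n} → i ℤ.+ + N ≡ -[1+ n ] → N ℕ.≤ ∣ i ∣
i+N≡-[1+n]⇒N≤∣i∣ (+ m)    N ()
i+N≡-[1+n]⇒N≤∣i∣ -[1+ m ] N eq with N ℕ.≤? suc m
... | yes N≤1+m = N≤1+m
... | no  N≰1+m with ≡.trans (≡.sym (ℤ.⊖-≥ (ℕ.<⇒≤ (ℕ.≰⇒> N≰1+m)))) eq
... | ()

module ReducedPowerLifting (G : SimpleGraph) (k : ℕ) where

  Tuple : Set
  Tuple = Vec (V G) (suc k)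

  _≈ᴿ_ : Tuple → Tuple → Set
  _≈ᴿ_ = _≈_ (ReducedPower G k)

  ≃-resp-≈ᴿ : ∀ {x x′ y y′ : Tuple} → x′ ≈ᴿ x → y′ ≈ᴿ y →
    ReducedPower G k ⊢ x ≃ y → ReducedPower G k ⊢ x′ ≃ y′
  ≃-resp-≈ᴿ x′≈x y′≈y (inj₁ x≈y) = inj₁ (trans (trans x′≈x x≈y) (↭-sym y′≈y))
  ≃-resp-≈ᴿ x′≈x y′≈y (inj₂ (u , w , m , u~w , x≈um , y≈wm)) =
    inj₂ (u , w , m , u~w , trans x′≈x x≈um , trans y′≈y y≈wm)

  lift-step : ∀ {a c x : Tuple} → ReducedPower G k ⊢ a ≃ c → x ≈ᴿ a →
    Σ[ y ∈ Tuple ] y ≈ᴿ c × Power G (suc k) ⊢ x ≃ y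
  lift-step {x = x} (inj₁ a≈c) x≈a = x , trans x≈a a≈c , inj₁ refl
  lift-step {x = x} (inj₂ (u , w , m , u~w , a≈um , c≈wm)) x≈a
    with p , xₚ≡u ← ∈-toList⇒lookup (∈-resp-↭ (↭-sym (trans x≈a a≈um)) (here refl))
    with r , x↭xₚr , x[p]≔w↭wr ← toList-↭-lookup∷ x p w
    = x [ p ]≔ w , trans x[p]≔w↭wr (trans (prep w r↭m) (↭-sym c≈wm)) , inj₂ (p , xₚ~w , others)
    where
    r↭m : r ↭ toList m
    r↭m = drop-∷ (trans (↭-sym (subst (λ z → toList x ↭ z ∷ r) xₚ≡u x↭xₚr)) (trans x≈a a≈um))

    xₚ~w : _~_ G (lookup x p) (lookup (x [ p ]≔ w) p)
    xₚ~w rewrite xₚ≡u | lookup∘update p x w = u~w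

    others : ∀ j → j ≡.≢ p → lookup x j ≡ lookup (x [ p ]≔ w) j
    others j j≢p = ≡.sym (lookup∘update′ j≢p x w)

  module PathLifting (s : ℕ → Tuple) (s-adj : ∀ t → ReducedPower G k ⊢ s t ≃ s (suc t))
                     (x₀ : Tuple) (x₀≈s₀ : x₀ ≈ᴿ s 0) where

    lift : (t : ℕ) → Σ[ x ∈ Tuple ] x ≈ᴿ s t
    lift 0       = x₀ , x₀≈s₀
    lift (suc t) = proj₁ (lift-step (s-adj t) (proj₂ (lift t))) ,
                   proj₁ (proj₂ (lift-step (s-adj t) (proj₂ (lift t))))

    lift-adj : ∀ t → Power G (suc k) ⊢ proj₁ (lift t) ≃ proj₁ (lift (suc t))
    lift-adj t = proj₂ (proj₂ (lift-step (s-adj t) (proj₂ (lift t))))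

  ≈ᴿ-pointwise⇒homotopic : ∀ {x₀} (f : ℤ → Tuple) (g : BasedLoop (ReducedPower G k) x₀) →
    (∀ i → f i ≈ᴿ loop g i) → BasedHomotopic (ReducedPower G k) x₀ f (loop g)
  ≈ᴿ-pointwise⇒homotopic f g f≈g =
      0 , (λ i _ → f i)
    , (λ i _ _ → ≃-resp-≈ᴿ (f≈g i) (f≈g (i ℤ.+ ℤ.1ℤ)) (isGraphMap g i))
    , (λ _ _ ())
    , (λ _ _ → proj₁ (based g) , λ i N≤∣i∣ → trans (f≈g i) (proj₂ (based g) i N≤∣i∣))
    , (λ _ → refl)
    , f≈g

  module LoopLifting (v₀ : V G) (g : BasedLoop (ReducedPower G k) (replicate (suc k) v₀)) where

    N : ℕ
    N = proj₁ (based g)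

    g-based : ∀ i → N ℕ.≤ ∣ i ∣ → loop g i ≈ᴿ replicate (suc k) v₀
    g-based = proj₂ (based g)

    start : ℤ
    start = ℤ.- (+ N)

    s : ℕ → Tuple
    s t = loop g (start ℤ.+ + t)

    s-adj : ∀ t → ReducedPower G k ⊢ s t ≃ s (suc t)
    s-adj t = subst (λ j → ReducedPower G k ⊢ s t ≃ loop g j)
                    (i+[+n]+1≡i+[+1+n] start t) (isGraphMap g (start ℤ.+ + t))

    N≤∣start+0∣ : N ℕ.≤ ∣ start ℤ.+ + 0 ∣
    N≤∣start+0∣ = ℕ.≤-reflexive (≡.sym (≡.trans (cong ∣_∣ (ℤ.+-identityʳ start)) (ℤ.∣-i∣≡∣i∣ (+ N))))

    open PathLifting s s-adj (replicate (suc k) v₀) (↭-sym (g-based (start ℤ.+ + 0) N≤∣start+0∣))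

    -- Before time -N the loop g sits at the base point, so the lift may stay there too.
    path : ℤ → Tuple
    path (+ t)     = proj₁ (lift t)
    path -[1+ _ ] = replicate (suc k) v₀

    path-adj : ∀ z → Power G (suc k) ⊢ path z ≃ path (z ℤ.+ ℤ.1ℤ)
    path-adj (+ t)        = subst (λ u → Power G (suc k) ⊢ path (+ t) ≃ path (+ u))
                                  (ℕ.+-comm 1 t) (lift-adj t)
    path-adj -[1+ 0 ]     = inj₁ refl
    path-adj -[1+ suc _ ] = inj₁ refl

    lifted : ℤ → Tuple
    lifted i = path (i ℤ.+ + N)

    lifted-adj : ∀ i → Power G (suc k) ⊢ lifted i ≃ lifted (i ℤ.+ ℤ.1ℤ)
    lifted-adj i = subst (λ z → Power G (suc k) ⊢ lifted i ≃ path z)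
                         (i+n+1≡i+1+n i (+ N)) (path-adj (i ℤ.+ + N))

    lifted≈g : ∀ i → lifted i ≈ᴿ loop g i
    lifted≈g i with i ℤ.+ + N in i+N≡
    ... | + t      = subst (λ j → proj₁ (lift t) ≈ᴿ loop g j)
                           (≡.trans (cong (λ j → start ℤ.+ j) (≡.sym i+N≡)) (-n+[i+n]≡i i (+ N)))
                           (proj₂ (lift t))
    ... | -[1+ _ ] = ↭-sym (g-based i (i+N≡-[1+n]⇒N≤∣i∣ i N i+N≡))

    liftedLoop : BasedLoop (Power G (suc k)) (replicate (suc k) v₀)
    liftedLoop = record
      { loop       = lifted
      ; isGraphMap = lifted-adj
      ; based      = N , λ i N≤∣i∣ →
          ↭-replicate⇒≡replicate (lifted i) (trans (lifted≈g i) (g-based i N≤∣i∣))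
      }

lemma4p5 : (G : SimpleGraph) → Connected G → LocallyFinite G →
    (k : ℕ) (v₀ : V G) →
    (g : BasedLoop (ReducedPower G k) (replicate (suc k) v₀)) →
    Σ (BasedLoop (Power G (suc k)) (replicate (suc k) v₀)) λ f →
      BasedHomotopic (ReducedPower G k) (replicate (suc k) v₀)
        (λ i → η {G} {k} (loop f i)) (loop g)
lemma4p5 G _ _ k v₀ g = liftedLoop , ≈ᴿ-pointwise⇒homotopic lifted g lifted≈g
  where
  open ReducedPowerLifting G k
  open LoopLifting v₀ g
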